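{- Let $t$ be the Thue–Morse word, the fixed point starting with $a$ of the morphism $a\mapsto abba$, $b\mapsto baab$, and for $n\ge 0$ let $d_t(n)=PPL_t(n+1)-PPL_t(n)$. Then each $d_t(n)\in\{ -1,0,+1\}$ and the infinite sequence $(d_t(n))_{n\ge 0}$ is the fixed point (starting with $+1$) of the $4$-uniform morphism $\delta$ on the alphabet $\{ -1,0,+1\}$ given by \[\delta(+1)=(+1)(+1)(0)(-1),\quad \delta(0)=(+1)(+1)(-1)(-1),\quad \delta(-1)=(+1)(0)(-1)(-1).\]
   Context: $PPL_t(n)$ is the minimal number of palindromes whose concatenation is the prefix of $t$ of length $n$, with $PPL_t(0)=0$. -}

module Defs where

open import Data.Nat using (ℕ; zero; suc; _+_; _*_; _≤_)
open import Data.Fin using (Fin; toℕ)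
open import Data.Vec using (Vec; []; _∷_; lookup)
open import Data.List using (List; length; concat; reverse; applyUpTo)
open import Data.List.Relation.Unary.All using (All)
open import Data.Integer using (ℤ; +_; -[1+_]; _-_)
open import Data.Product using (Σ; _×_)
open import Relation.Binary.PropositionalEquality using (_≡_)

data Letter : Set where
  a b : Letter

μ : Letter → Vec Letter 4
μ a = a ∷ b ∷ b ∷ a ∷ []
μ b = b ∷ a ∷ a ∷ b ∷ []

-- x : ℕ → A is the fixed point of the 4-uniform morphism σ starting with x₀,
-- i.e. x begins with x₀ and σ(x) = x (σ(x) has letter lookup (σ (x k)) i at position 4k+i).
IsFixedPoint : {A : Set} → (A → Vec A 4) → A → (ℕ → A) → Set
IsFixedPoint σ x₀ x = (x 0 ≡ x₀) × (∀ (k : ℕ) (i : Fin 4) → x (4 * k + toℕ i) ≡ lookup (σ (x k)) i)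

prefix : {A : Set} → (ℕ → A) → ℕ → List A
prefix x n = applyUpTo x n

IsPalindrome : {A : Set} → List A → Set
IsPalindrome w = reverse w ≡ w

PalFactorization : {A : Set} → List A → Set
PalFactorization {A} w = Σ (List (List A)) λ ps → (concat ps ≡ w) × All IsPalindrome ps

IsPPL : {A : Set} → List A → ℕ → Set
IsPPL w k =
  (Σ (PalFactorization w) λ f → length (Data.Product.proj₁ f) ≡ k)
  × (∀ (f : PalFactorization w) → k ≤ length (Data.Product.proj₁ f))

data Sgn : Set where
  neg zer pos : Sgn

toℤ : Sgn → ℤ
toℤ neg = -[1+ 0 ]
toℤ zer = + 0
toℤ pos = + 1

δ : Sgn → Vec Sgn 4
δ pos = pos ∷ pos ∷ zer ∷ neg ∷ []
δ zer = pos ∷ pos ∷ neg ∷ neg ∷ []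
δ neg = pos ∷ zer ∷ neg ∷ neg ∷ []

module Submission where

-- The palindromic length of the prefixes of the Thue–Morse word t is given by an explicit
-- 4-regular recursion, from which the description of its first differences by δ follows.
--
-- Let f : ℕ → ℕ be defined by f 0 = 0 and, for n = 4k + r,
--   f (4k) = f k,  f (4k+1) = f k + 1,  f (4k+2) = 2 + min (f k) (f (k+1)),  f (4k+3) = f (k+1) + 1.
-- 1. From the recursion alone: every step f n ↦ f (n+1) is a jump by -1, 0 or +1, and the jumps
--    in the block 4k … 4k+4 are the letters of δ(s), s being the jump from k to k+1.  So the
--    sequence d of jumps is the fixed point of δ starting with +1.
-- 2. Lower bound: in t, appending any palindrome raises f by at most one (pal-bound).  The proof is
--    by strong induction on the length: odd palindromes have length ≤ 3, and an even palindrome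
--    is never centred inside a pair t(2e) t(2e+1), so after trimming at most two letters on each
--    side it is the μ-image of a shorter palindrome.
--    Hence every palindromic factorization of t[0, n) has at least f n pieces.
-- 3. Upper bound: every nonempty prefix t[0, n) ends with a palindrome t[m, n) with f m < f n
--    (pal-suffix); iterating gives a factorization into at most f n palindromes.
-- Hence PPL_t(n) = f n, and the theorem follows from 1 (only μ(t) = t is used, not the first letter).

open import Defs
open import Data.Nat using (ℕ; zero; suc; _+_; _*_; _∸_; _⊓_; _≤_; _<_; _≤?_; z≤n; s≤s)
open import Data.Nat.Properties
open import Data.Nat.Induction using (<-rec)
open import Data.Nat.Tactic.RingSolver using (solve; solve-∀)
open import Data.Fin using (Fin; toℕ) renaming (zero to fz; suc to fs)
open import Data.Vec using (lookup)
open import Data.List using (List; []; _∷_; _++_; length; concat; reverse; applyUpTo; applyDownFrom)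
open import Data.List.Properties using (reverse-applyUpTo; ∷-injective; concat-++; length-++; ++-identityʳ)
open import Data.List.Relation.Unary.All as All using (All)
open import Data.List.Relation.Unary.All.Properties using (++⁺)
open import Data.Integer using (+_; -_; _-_; _⊖_; -[1+_])
open import Data.Integer.Properties using (m-n≡m⊖n; n⊖n≡0; ⊖-≥; ⊖-≤)
open import Data.Product using (Σ; ∃; _×_; _,_; proj₁; proj₂; map₁)
open import Data.Sum using (_⊎_; inj₁; inj₂)
open import Data.Empty using (⊥; ⊥-elim)
open import Relation.Nullary using (yes; no)
open import Relation.Binary.PropositionalEquality

data Mod4 : ℕ → Set where
  rem0 : ∀ k → Mod4 (4 * k)
  rem1 : ∀ k → Mod4 (1 + 4 * k)
  rem2 : ∀ k → Mod4 (2 + 4 * k)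
  rem3 : ∀ k → Mod4 (3 + 4 * k)

4+4k≡4[1+k] : ∀ k → 4 + 4 * k ≡ 4 * suc k
4+4k≡4[1+k] = solve-∀

2+k<4[1+k] : ∀ k → 2 + k < 4 * suc k
2+k<4[1+k] k = subst (3 + k ≤_) (sum≡ k) (m≤m+n (3 + k) (1 + 3 * k))
  where
  sum≡ : ∀ k → 3 + k + (1 + 3 * k) ≡ 4 * suc k
  sum≡ = solve-∀

mod4 : ∀ n → Mod4 n
mod4 zero = rem0 0
mod4 (suc n) with mod4 n
... | rem0 k = rem1 k
... | rem1 k = rem2 k
... | rem2 k = rem3 k
... | rem3 k = subst Mod4 (sym (4+4k≡4[1+k] k)) (rem0 (suc k))

parity : ∀ e → ∃ λ h → (e ≡ 2 * h) ⊎ (e ≡ 1 + 2 * h)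
parity zero = 0 , inj₁ refl
parity (suc e) with parity e
... | h , inj₁ refl = h , inj₂ refl
... | h , inj₂ refl = suc h , inj₁ (cong suc (sym (+-suc h (h + 0))))

quotRem : ℕ → ℕ × Fin 4
quotRem 0 = 0 , fz
quotRem 1 = 0 , fs fz
quotRem 2 = 0 , fs (fs fz)
quotRem 3 = 0 , fs (fs (fs fz))
quotRem (suc (suc (suc (suc n)))) = map₁ suc (quotRem n)

quotRem-spec : ∀ n → n ≡ toℕ (proj₂ (quotRem n)) + 4 * proj₁ (quotRem n)
quotRem-spec 0 = refl
quotRem-spec 1 = refl
quotRem-spec 2 = refl
quotRem-spec 3 = refl
quotRem-spec (suc (suc (suc (suc n)))) =
  trans (cong (λ m → 4 + m) (quotRem-spec n)) (shift (toℕ (proj₂ (quotRem n))) (proj₁ (quotRem n)))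
  where
  shift : ∀ r k → 4 + (r + 4 * k) ≡ r + 4 * suc k
  shift = solve-∀

quotRem-of : ∀ r k → quotRem (toℕ r + 4 * k) ≡ (k , r)
quotRem-of fz zero = refl
quotRem-of (fs fz) zero = refl
quotRem-of (fs (fs fz)) zero = refl
quotRem-of (fs (fs (fs fz))) zero = refl
quotRem-of r (suc k) = begin
    quotRem (toℕ r + 4 * suc k)      ≡⟨ cong quotRem (shift (toℕ r) k) ⟩
    map₁ suc (quotRem (toℕ r + 4 * k)) ≡⟨ cong (map₁ suc) (quotRem-of r k) ⟩
    (suc k , r)                        ∎
  where
  open ≡-Reasoning
  shift : ∀ r k → r + 4 * suc k ≡ 4 + (r + 4 * k)
  shift = solve-∀

recStep : (ℕ → ℕ) → ℕ × Fin 4 → ℕ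
recStep g (k , fz)              = g k
recStep g (k , fs fz)           = suc (g k)
recStep g (k , fs (fs fz))      = 2 + (g k ⊓ g (suc k))
recStep g (k , fs (fs (fs fz))) = suc (g (suc k))

recStep-cong : ∀ {g h} k r → g k ≡ h k → (2 ≤ toℕ r → g (suc k) ≡ h (suc k)) →
               recStep g (k , r) ≡ recStep h (k , r)
recStep-cong k fz              gk _    = gk
recStep-cong k (fs fz)         gk _    = cong suc gk
recStep-cong k (fs (fs fz))    gk gk+1 = cong₂ (λ x y → 2 + (x ⊓ y)) gk (gk+1 (s≤s (s≤s z≤n)))
recStep-cong k (fs (fs (fs fz))) _ gk+1 = cong suc (gk+1 (s≤s (s≤s z≤n)))

-- The recursion run with a fuel bound; it is only used with fuel ≥ n.
fuelled : ℕ → ℕ → ℕ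
fuelled zero       n = 0
fuelled (suc fuel) n = recStep (fuelled fuel) (quotRem n)

quot≤fuel : ∀ (r : Fin 4) k {fuel} → toℕ r + 4 * k ≤ suc fuel → k ≤ fuel
quot≤fuel r zero    _  = z≤n
quot≤fuel r (suc k) le = ≤-pred (≤-trans (<⇒≤ (2+k<4[1+k] k)) (≤-trans (m≤n+m (4 * suc k) (toℕ r)) le))

quot<fuel : ∀ (r : Fin 4) k {fuel} → 2 ≤ toℕ r → toℕ r + 4 * k ≤ suc fuel → suc k ≤ fuel
quot<fuel r k 2≤r le = ≤-trans (s≤s (m≤n*m k 4)) (≤-pred (≤-trans (+-monoˡ-≤ (4 * k) 2≤r) le))

fuel-step : ∀ fuel n → n ≤ fuel → fuelled (suc fuel) n ≡ fuelled fuel n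
fuel-step zero       zero _  = refl
fuel-step (suc fuel) n    le with quotRem n | quotRem-spec n
... | k , r | n≡ = recStep-cong k r
  (fuel-step fuel k (quot≤fuel r k (subst (_≤ suc fuel) n≡ le)))
  (λ 2≤r → fuel-step fuel (suc k) (quot<fuel r k 2≤r (subst (_≤ suc fuel) n≡ le)))

fuel-enough : ∀ fuel n → n ≤ fuel → fuelled fuel n ≡ fuelled n n
fuel-enough fuel n le with m≤n⇒∃[o]m+o≡n le
... | extra , refl = surplus extra
  where
  surplus : ∀ d → fuelled (n + d) n ≡ fuelled n n
  surplus zero    = cong (λ m → fuelled m n) (+-identityʳ n)
  surplus (suc d) = begin
    fuelled (n + suc d) n ≡⟨ cong (λ m → fuelled m n) (+-suc n d) ⟩
    fuelled (suc (n + d)) n ≡⟨ fuel-step (n + d) n (m≤m+n n d) ⟩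
    fuelled (n + d) n       ≡⟨ surplus d ⟩
    fuelled n n             ∎
    where open ≡-Reasoning

-- The function that will turn out to be PPL_t.
f : ℕ → ℕ
f n = fuelled n n

f-recursion : ∀ n → f n ≡ recStep f (quotRem n)
f-recursion zero    = refl
f-recursion (suc n) with quotRem (suc n) | quotRem-spec (suc n)
... | k , r | n≡ = recStep-cong k r
  (fuel-enough n k (quot≤fuel r k (≤-reflexive (sym n≡))))
  (λ 2≤r → fuel-enough n (suc k) (quot<fuel r k 2≤r (≤-reflexive (sym n≡))))

f-unfold : ∀ r k → f (toℕ r + 4 * k) ≡ recStep f (k , r)
f-unfold r k = trans (f-recursion (toℕ r + 4 * k)) (cong (recStep f) (quotRem-of r k))

f-4k : ∀ k → f (4 * k) ≡ f k
f-4k = f-unfold fz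

f-4k+1 : ∀ k → f (1 + 4 * k) ≡ suc (f k)
f-4k+1 = f-unfold (fs fz)

f-4k+2 : ∀ k → f (2 + 4 * k) ≡ 2 + (f k ⊓ f (suc k))
f-4k+2 = f-unfold (fs (fs fz))

f-4k+3 : ∀ k → f (3 + 4 * k) ≡ suc (f (suc k))
f-4k+3 = f-unfold (fs (fs (fs fz)))

Jump : ℕ → ℕ → Sgn → Set
Jump m n pos = n ≡ suc m
Jump m n zer = n ≡ m
Jump m n neg = suc n ≡ m

jump-unique : ∀ {m n} s s′ → Jump m n s → Jump m n s′ → s ≡ s′
jump-unique pos pos _ _ = refl
jump-unique zer zer _ _ = refl
jump-unique neg neg _ _ = refl
jump-unique pos zer refl n≡m = ⊥-elim (1+n≢n n≡m)
jump-unique zer pos refl n≡1+m = ⊥-elim (1+n≢n (sym n≡1+m))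
jump-unique pos neg refl 2+m≡m = ⊥-elim (m≢1+n+m _ {1} (sym 2+m≡m))
jump-unique neg pos 1+n≡m refl = ⊥-elim (m≢1+n+m _ {1} (sym 1+n≡m))
jump-unique zer neg refl 1+m≡m = ⊥-elim (1+n≢n 1+m≡m)
jump-unique neg zer 1+n≡m refl = ⊥-elim (1+n≢n 1+n≡m)

jump-ℤ : ∀ {m n} s → Jump m n s → toℤ s ≡ + n - + m
jump-ℤ {m} pos refl = sym (begin
  + suc m - + m ≡⟨ m-n≡m⊖n (suc m) m ⟩
  suc m ⊖ m     ≡⟨ ⊖-≥ (n≤1+n m) ⟩
  + (1 + m ∸ m) ≡⟨ cong +_ (m+n∸n≡m 1 m) ⟩
  + 1           ∎)
  where open ≡-Reasoning
jump-ℤ {m} zer refl = sym (trans (m-n≡m⊖n m m) (n⊖n≡0 m))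
jump-ℤ {n = n} neg refl = sym (begin
  + n - + suc n   ≡⟨ m-n≡m⊖n n (suc n) ⟩
  n ⊖ suc n       ≡⟨ ⊖-≤ (n≤1+n n) ⟩
  - + (1 + n ∸ n) ≡⟨ cong (λ x → - + x) (m+n∸n≡m 1 n) ⟩
  -[1+ 0 ]        ∎)
  where open ≡-Reasoning

jump≤ : ∀ {m n} s → Jump m n s → n ≤ suc m
jump≤ pos refl = ≤-refl
jump≤ zer refl = n≤1+n _
jump≤ neg refl = ≤-trans (n≤1+n _) (n≤1+n _)

jump-4k : ∀ k → Jump (f (4 * k)) (f (1 + 4 * k)) pos
jump-4k k = trans (f-4k+1 k) (cong suc (sym (f-4k k)))

jump-4k+1 : ∀ k s → Jump (f k) (f (suc k)) s → Jump (f (1 + 4 * k)) (f (2 + 4 * k)) (lookup (δ s) (fs fz))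
jump-4k+1 k pos f[k+1]≡ rewrite f-4k+2 k | f-4k+1 k | f[k+1]≡ | m≤n⇒m⊓n≡m (n≤1+n (f k)) = refl
jump-4k+1 k zer f[k+1]≡ rewrite f-4k+2 k | f-4k+1 k | f[k+1]≡ | ⊓-idem (f k) = refl
jump-4k+1 k neg f[k]≡ rewrite f-4k+2 k | f-4k+1 k | sym f[k]≡ | m≥n⇒m⊓n≡n (n≤1+n (f (suc k))) = refl

jump-4k+2 : ∀ k s → Jump (f k) (f (suc k)) s → Jump (f (2 + 4 * k)) (f (3 + 4 * k)) (lookup (δ s) (fs (fs fz)))
jump-4k+2 k pos f[k+1]≡ rewrite f-4k+2 k | f-4k+3 k | f[k+1]≡ | m≤n⇒m⊓n≡m (n≤1+n (f k)) = refl
jump-4k+2 k zer f[k+1]≡ rewrite f-4k+2 k | f-4k+3 k | f[k+1]≡ | ⊓-idem (f k) = refl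
jump-4k+2 k neg f[k]≡ rewrite f-4k+2 k | f-4k+3 k | sym f[k]≡ | m≥n⇒m⊓n≡n (n≤1+n (f (suc k))) = refl

jump-4k+3 : ∀ k → Jump (f (3 + 4 * k)) (f (4 + 4 * k)) neg
jump-4k+3 k = begin
  suc (f (4 + 4 * k))  ≡⟨ cong (λ m → suc (f m)) (4+4k≡4[1+k] k) ⟩
  suc (f (4 * suc k))  ≡⟨ cong suc (f-4k (suc k)) ⟩
  suc (f (suc k))      ≡⟨ sym (f-4k+3 k) ⟩
  f (3 + 4 * k)        ∎
  where open ≡-Reasoning

-- Every step of f is a jump by -1, 0 or +1 (strong induction: a step inside a block
-- is determined by the step from k to k + 1, and k is smaller).
jumps : ∀ n → ∃ (Jump (f n) (f (suc n)))
jumps = <-rec _ step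
  where
  step : ∀ n → (∀ {m} → m < n → ∃ (Jump (f m) (f (suc m)))) → ∃ (Jump (f n) (f (suc n)))
  step n ih with mod4 n
  ... | rem0 k = pos , jump-4k k
  ... | rem1 k = let (s , j) = ih (s≤s (m≤n*m k 4)) in _ , jump-4k+1 k s j
  ... | rem2 k = let (s , j) = ih (s≤s (≤-trans (m≤n*m k 4) (n≤1+n _))) in _ , jump-4k+2 k s j
  ... | rem3 k = neg , jump-4k+3 k

d : ℕ → Sgn
d n = proj₁ (jumps n)

d-jump : ∀ n → Jump (f n) (f (suc n)) (d n)
d-jump n = proj₂ (jumps n)

d-unique : ∀ n s → Jump (f n) (f (suc n)) s → d n ≡ s
d-unique n s = jump-unique (d n) s (d-jump n)

d-fixedPoint : IsFixedPoint δ pos d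
d-fixedPoint = d-unique 0 pos (jump-4k 0) , block
  where
  block : ∀ k (i : Fin 4) → d (4 * k + toℕ i) ≡ lookup (δ (d k)) i
  block k i rewrite +-comm (4 * k) (toℕ i) = atOffset i
    where
    δ-first : ∀ s → pos ≡ lookup (δ s) fz
    δ-first pos = refl
    δ-first zer = refl
    δ-first neg = refl

    δ-last : ∀ s → neg ≡ lookup (δ s) (fs (fs (fs fz)))
    δ-last pos = refl
    δ-last zer = refl
    δ-last neg = refl

    atOffset : ∀ i → d (toℕ i + 4 * k) ≡ lookup (δ (d k)) i
    atOffset fz = d-unique (4 * k) _ (subst (Jump _ _) (δ-first (d k)) (jump-4k k))
    atOffset (fs fz) = d-unique (1 + 4 * k) _ (jump-4k+1 k (d k) (d-jump k))
    atOffset (fs (fs fz)) = d-unique (2 + 4 * k) _ (jump-4k+2 k (d k) (d-jump k))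
    atOffset (fs (fs (fs fz))) = d-unique (3 + 4 * k) _ (subst (Jump _ _) (δ-last (d k)) (jump-4k+3 k))

⊓-jump : ∀ {A B C D} → A ≤ suc D → B ≤ suc C → A ⊓ B ≤ suc (C ⊓ D)
⊓-jump {A} {B} A≤ B≤ = ≤-trans (≤-reflexive (⊓-comm A B)) (⊓-mono-≤ B≤ A≤)

applyUpTo-cong : ∀ {A : Set} (g h : ℕ → A) n → (∀ i → i < n → g i ≡ h i) → applyUpTo g n ≡ applyUpTo h n
applyUpTo-cong g h zero    _   = refl
applyUpTo-cong g h (suc n) g≡h =
  cong₂ _∷_ (g≡h 0 (s≤s z≤n)) (applyUpTo-cong (λ i → g (suc i)) (λ i → h (suc i)) n (λ i i<n → g≡h (suc i) (s≤s i<n)))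

applyUpTo-pointwise : ∀ {A : Set} (g h : ℕ → A) n → applyUpTo g n ≡ applyUpTo h n → ∀ i → i < n → g i ≡ h i
applyUpTo-pointwise g h (suc n) eq zero    _         = proj₁ (∷-injective eq)
applyUpTo-pointwise g h (suc n) eq (suc i) (s≤s i<n) =
  applyUpTo-pointwise (λ i → g (suc i)) (λ i → h (suc i)) n (proj₂ (∷-injective eq)) i i<n

reverse-window : ∀ {A : Set} (g : ℕ → A) n → reverse (applyUpTo g n) ≡ applyUpTo (λ i → g (n ∸ suc i)) n
reverse-window g n = trans (reverse-applyUpTo g n) (downFrom≡upTo n)
  where
  downFrom≡upTo : ∀ n → applyDownFrom g n ≡ applyUpTo (λ i → g (n ∸ suc i)) n
  downFrom≡upTo zero    = refl
  downFrom≡upTo (suc n) = cong (g n ∷_) (downFrom≡upTo n)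

applyUpTo-++ : ∀ {A : Set} (g : ℕ → A) m n → applyUpTo g m ++ applyUpTo (λ i → g (m + i)) n ≡ applyUpTo g (m + n)
applyUpTo-++ g zero    n = refl
applyUpTo-++ g (suc m) n = cong (g 0 ∷_) (applyUpTo-++ (λ i → g (suc i)) m n)

applyUpTo-split : ∀ {A : Set} (p q : List A) (g : ℕ → A) n → p ++ q ≡ applyUpTo g n →
  Σ ℕ λ m → (length p + m ≡ n) × (p ≡ applyUpTo g (length p)) × (q ≡ applyUpTo (λ i → g (length p + i)) m)
applyUpTo-split []      q g n       eq = n , refl , refl , eq
applyUpTo-split (x ∷ p) q g (suc n) eq with ∷-injective eq
... | x≡ , rest with applyUpTo-split p q (λ i → g (suc i)) n rest
... | m , len , p≡ , q≡ = m , cong suc len , cong₂ _∷_ x≡ p≡ , q≡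

module Palindromes {A : Set} (w : ℕ → A) where

  PalAt : ℕ → ℕ → Set
  PalAt s L = ∀ i j → suc (i + j) ≡ L → w (s + i) ≡ w (s + j)

  pal-empty : ∀ s → PalAt s 0
  pal-empty s i j ()

  pal-letter : ∀ s → PalAt s 1
  pal-letter s zero    zero    _ = refl
  pal-letter s zero    (suc j) ()
  pal-letter s (suc i) j       ()

  wrap : ∀ {s L} → w s ≡ w (s + suc L) → PalAt (suc s) L → PalAt s (2 + L)
  wrap {s} {L} e p = pal
    where
    outer : ∀ j → suc j ≡ 2 + L → w (s + 0) ≡ w (s + j)
    outer .(suc L) refl = trans (cong w (+-identityʳ s)) e

    pal : PalAt s (2 + L)
    pal zero    j       q = outer j q
    pal (suc i) zero    q = sym (outer (suc i) (trans (cong (λ x → suc (suc x)) (sym (+-identityʳ i))) q))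
    pal (suc i) (suc j) q = begin
      w (s + suc i) ≡⟨ cong w (+-suc s i) ⟩
      w (suc s + i) ≡⟨ p i j (trans (sym (+-suc i j)) (suc-injective (suc-injective q))) ⟩
      w (suc s + j) ≡⟨ cong w (sym (+-suc s j)) ⟩
      w (s + suc j) ∎
      where open ≡-Reasoning

  peel : ∀ {s L} → PalAt s (2 + L) → PalAt (suc s) L
  peel {s} p i j q = begin
    w (suc s + i) ≡⟨ cong w (sym (+-suc s i)) ⟩
    w (s + suc i) ≡⟨ p (suc i) (suc j) (cong (λ x → suc (suc x)) (trans (+-suc i j) q)) ⟩
    w (s + suc j) ≡⟨ cong w (+-suc s j) ⟩
    w (suc s + j) ∎
    where open ≡-Reasoning

  ends : ∀ {s L} → PalAt s (2 + L) → w s ≡ w (s + suc L)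
  ends {s} {L} p = trans (cong w (sym (+-identityʳ s))) (p 0 (suc L) refl)

  centre : ∀ {s} h → PalAt s (2 + 2 * h) → w (s + h) ≡ w (s + suc h)
  centre h p = p h (suc h) (length≡ h)
    where
    length≡ : ∀ h → suc (h + suc h) ≡ 2 + 2 * h
    length≡ = solve-∀

  factor : ℕ → ℕ → List A
  factor s n = applyUpTo (λ i → w (s + i)) n

  palindrome⇒PalAt : ∀ s L → IsPalindrome (factor s L) → PalAt s L
  palindrome⇒PalAt s L rev≡ i j q = sym (begin
    w (s + j)           ≡⟨ cong (λ x → w (s + x)) (sym L∸[1+i]≡j) ⟩
    w (s + (L ∸ suc i)) ≡⟨ applyUpTo-pointwise _ _ L (trans (sym (reverse-window _ L)) rev≡) i i<L ⟩
    w (s + i)           ∎)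
    where
    open ≡-Reasoning
    i<L : i < L
    i<L = ≤-trans (s≤s (m≤m+n i j)) (≤-reflexive q)
    L∸[1+i]≡j : L ∸ suc i ≡ j
    L∸[1+i]≡j = trans (cong (_∸ suc i) (sym q)) (m+n∸m≡n i j)

  PalAt⇒palindrome : ∀ s L → PalAt s L → IsPalindrome (factor s L)
  PalAt⇒palindrome s L p = trans (reverse-window _ L)
    (applyUpTo-cong _ _ L (λ i i<L → sym (p i (L ∸ suc i) (m+[n∸m]≡n i<L))))

  shifted-factor : ∀ s m n → applyUpTo (λ i → w (s + (m + i))) n ≡ factor (s + m) n
  shifted-factor s m n = applyUpTo-cong _ _ n (λ i _ → cong w (sym (+-assoc s m i)))

pad : ∀ {A : Set} {w : List A} d (fc : PalFactorization w) →
      Σ (PalFactorization w) λ fc′ → length (proj₁ fc′) ≡ d + length (proj₁ fc)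
pad zero    fc = fc , refl
pad (suc d) fc with pad d fc
... | (ps , concat≡ , pals) , len≡ = ([] ∷ ps , concat≡ , refl All.∷ pals) , cong suc len≡

IsPPL-intro : ∀ {A : Set} {w : List A} {k} (fc : PalFactorization w) → length (proj₁ fc) ≤ k →
              (∀ fc′ → k ≤ length (proj₁ fc′)) → IsPPL w k
IsPPL-intro {k = k} fc ≤k minimal with pad (k ∸ length (proj₁ fc)) fc
... | fc′ , len≡ = (fc′ , trans len≡ (m∸n+n≡m ≤k)) , minimal

IsPPL-unique : ∀ {A : Set} {w : List A} {k k′} → IsPPL w k → IsPPL w k′ → k ≡ k′
IsPPL-unique ((fc , len≡) , minimal) ((fc′ , len′≡) , minimal′) =
  ≤-antisym (subst (_ ≤_) len′≡ (minimal fc′)) (subst (_ ≤_) len≡ (minimal′ fc))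

flip : Letter → Letter
flip a = b
flip b = a

flip-injective : ∀ {x y} → flip x ≡ flip y → x ≡ y
flip-injective {a} {a} _ = refl
flip-injective {b} {b} _ = refl

flip-no-fixpoint : ∀ x → flip x ≢ x
flip-no-fixpoint a ()
flip-no-fixpoint b ()

μ-0 : ∀ x → lookup (μ x) fz ≡ x
μ-0 a = refl
μ-0 b = refl

μ-1 : ∀ x → lookup (μ x) (fs fz) ≡ flip x
μ-1 a = refl
μ-1 b = refl

μ-2 : ∀ x → lookup (μ x) (fs (fs fz)) ≡ flip x
μ-2 a = refl
μ-2 b = refl

μ-3 : ∀ x → lookup (μ x) (fs (fs (fs fz))) ≡ x
μ-3 a = refl
μ-3 b = refl

module ThueMorse (t : ℕ → Letter) (t-fixed : ∀ k (i : Fin 4) → t (4 * k + toℕ i) ≡ lookup (μ (t k)) i) where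
  open Palindromes t

  t-4k : ∀ {p} k → p ≡ 4 * k → t p ≡ t k
  t-4k k refl = trans (cong t (sym (+-identityʳ (4 * k)))) (trans (t-fixed k fz) (μ-0 (t k)))

  t-4k+1 : ∀ {p} k → p ≡ 1 + 4 * k → t p ≡ flip (t k)
  t-4k+1 k refl = trans (cong t (+-comm 1 (4 * k))) (trans (t-fixed k (fs fz)) (μ-1 (t k)))

  t-4k+2 : ∀ {p} k → p ≡ 2 + 4 * k → t p ≡ flip (t k)
  t-4k+2 k refl = trans (cong t (+-comm 2 (4 * k))) (trans (t-fixed k (fs (fs fz))) (μ-2 (t k)))

  t-4k+3 : ∀ {p} k → p ≡ 3 + 4 * k → t p ≡ t k
  t-4k+3 k refl = trans (cong t (+-comm 3 (4 * k))) (trans (t-fixed k (fs (fs (fs fz)))) (μ-3 (t k)))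

  pair-differs : ∀ e → t (2 * e) ≢ t (suc (2 * e))
  pair-differs e eq with parity e
  ... | h , inj₁ refl = flip-no-fixpoint (t h)
    (trans (sym (t-4k+1 {suc (2 * (2 * h))} h (solve (h ∷ [])))) (trans (sym eq) (t-4k {2 * (2 * h)} h (solve (h ∷ [])))))
  ... | h , inj₂ refl = flip-no-fixpoint (t h)
    (trans (sym (t-4k+2 {2 * (1 + 2 * h)} h (solve (h ∷ [])))) (trans eq (t-4k+3 {suc (2 * (1 + 2 * h))} h (solve (h ∷ [])))))

  even-centre : ∀ s h e → s + h ≡ 2 * e → PalAt s (2 + 2 * h) → ⊥
  even-centre s h e s+h≡2e p =
    pair-differs e (subst₂ (λ x y → t x ≡ t y) s+h≡2e (trans (+-suc s h) (cong suc s+h≡2e)) (centre h p))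

  at-4[1+k] : ∀ {k L} → PalAt (4 + 4 * k) L → PalAt (4 * suc k) L
  at-4[1+k] {k} {L} = subst (λ s → PalAt s L) (4+4k≡4[1+k] k)

  lift : ∀ m L → PalAt m L → PalAt (4 * m) (4 * L)
  lift m zero          p = pal-empty (4 * m)
  lift m (suc zero)    p = wrap (trans (t-4k m refl) (sym (t-4k+3 m (+-comm (4 * m) 3))))
                             (wrap (trans (t-4k+1 m refl) (sym (t-4k+2 m (solve (m ∷ []))))) (pal-empty _))
  lift m (suc (suc L)) p = subst (PalAt (4 * m)) (length≡ L) p₀
    where
    M : ℕ
    M = m + suc L
    end₃ : ∀ m L → 3 + 4 * m + suc (4 * L) ≡ 4 * (m + suc L)
    end₃ = solve-∀
    end₂ : ∀ m L → 2 + 4 * m + suc (2 + 4 * L) ≡ 1 + 4 * (m + suc L)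
    end₂ = solve-∀
    end₁ : ∀ m L → 1 + 4 * m + suc (4 + 4 * L) ≡ 2 + 4 * (m + suc L)
    end₁ = solve-∀
    end₀ : ∀ m L → 4 * m + suc (6 + 4 * L) ≡ 3 + 4 * (m + suc L)
    end₀ = solve-∀
    length≡ : ∀ L → 8 + 4 * L ≡ 4 * suc (suc L)
    length≡ = solve-∀

    m≡M : t m ≡ t M
    m≡M = ends p
    -- the image of the inner palindrome t[m+1, M), around which the images μ(t m) and μ(t M) of the
    -- equal outer letters are wrapped one letter at a time
    inner : PalAt (4 + 4 * m) (4 * L)
    inner = subst (λ s → PalAt s (4 * L)) (sym (4+4k≡4[1+k] m)) (lift (suc m) L (peel p))
    p₃ : PalAt (3 + 4 * m) (2 + 4 * L)
    p₃ = wrap (trans (t-4k+3 m refl) (trans m≡M (sym (t-4k M (end₃ m L))))) inner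
    p₂ : PalAt (2 + 4 * m) (4 + 4 * L)
    p₂ = wrap (trans (t-4k+2 m refl) (trans (cong flip m≡M) (sym (t-4k+1 M (end₂ m L))))) p₃
    p₁ : PalAt (1 + 4 * m) (6 + 4 * L)
    p₁ = wrap (trans (t-4k+1 m refl) (trans (cong flip m≡M) (sym (t-4k+2 M (end₁ m L))))) p₂
    p₀ : PalAt (4 * m) (8 + 4 * L)
    p₀ = wrap (trans (t-4k m refl) (trans m≡M (sym (t-4k+3 M (end₀ m L))))) p₁

  descend-4k : ∀ σ M → PalAt (4 * σ) (4 * M) → PalAt σ M
  descend-4k σ M p i j len≡M = begin
    t (σ + i)                 ≡⟨ sym (t-4k (σ + i) (solve (σ ∷ i ∷ []))) ⟩
    t (4 * σ + 4 * i)         ≡⟨ p (4 * i) (3 + 4 * j) (trans (length≡ i j) (cong (4 *_) len≡M)) ⟩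
    t (4 * σ + (3 + 4 * j))   ≡⟨ t-4k+3 (σ + j) (solve (σ ∷ j ∷ [])) ⟩
    t (σ + j)                 ∎
    where
    open ≡-Reasoning
    length≡ : ∀ i j → suc (4 * i + (3 + 4 * j)) ≡ 4 * suc (i + j)
    length≡ = solve-∀

  descend-4k+1 : ∀ σ q → PalAt (1 + 4 * σ) (2 + 4 * q) → PalAt σ (suc q)
  descend-4k+1 σ q p i j len≡ = flip-injective (begin
    flip (t (σ + i))              ≡⟨ sym (t-4k+1 (σ + i) (solve (σ ∷ i ∷ []))) ⟩
    t (1 + 4 * σ + 4 * i)         ≡⟨ p (4 * i) (1 + 4 * j) (trans (length≡ i j) (cong (λ x → 2 + 4 * x) (suc-injective len≡))) ⟩
    t (1 + 4 * σ + (1 + 4 * j))   ≡⟨ t-4k+2 (σ + j) (solve (σ ∷ j ∷ [])) ⟩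
    flip (t (σ + j))              ∎)
    where
    open ≡-Reasoning
    length≡ : ∀ i j → suc (4 * i + (1 + 4 * j)) ≡ 2 + 4 * (i + j)
    length≡ = solve-∀

  no-pal3-at-4k : ∀ σ → PalAt (4 * σ) 3 → ⊥
  no-pal3-at-4k σ p = flip-no-fixpoint (t σ)
    (trans (sym (t-4k+2 σ (+-comm (4 * σ) 2))) (trans (sym (p 0 2 refl)) (t-4k σ (+-identityʳ _))))

  no-pal3-at-4k+1 : ∀ σ → PalAt (1 + 4 * σ) 3 → ⊥
  no-pal3-at-4k+1 σ p = flip-no-fixpoint (t σ)
    (trans (sym (t-4k+1 σ (+-identityʳ _))) (trans (p 0 2 refl) (t-4k+3 {1 + 4 * σ + 2} σ (solve (σ ∷ [])))))

  no-pal5 : ∀ s → PalAt s 5 → ⊥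
  no-pal5 s p with mod4 s
  ... | rem0 σ = no-pal3-at-4k+1 σ (peel p)
  ... | rem3 σ = no-pal3-at-4k (suc σ) (at-4[1+k] (peel p))
  ... | rem1 σ = flip-no-fixpoint (t σ) (trans σ̄≡σ′ (sym σ≡σ′))
    where
    σ≡σ′ : t σ ≡ t (suc σ)
    σ≡σ′ = flip-injective (trans (sym (t-4k+1 σ (+-identityʳ _)))
                            (trans (p 0 4 refl) (t-4k+1 {1 + 4 * σ + 4} (suc σ) (solve (σ ∷ [])))))
    σ̄≡σ′ : flip (t σ) ≡ t (suc σ)
    σ̄≡σ′ = trans (sym (t-4k+2 {1 + 4 * σ + 1} σ (solve (σ ∷ [])))) (trans (p 1 3 refl) (t-4k {1 + 4 * σ + 3} (suc σ) (solve (σ ∷ []))))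
  ... | rem2 σ = flip-no-fixpoint (t σ) (sym (trans σ≡σ̄′ (cong flip (sym σ≡σ′))))
    where
    σ≡σ′ : t σ ≡ t (suc σ)
    σ≡σ′ = flip-injective (trans (sym (t-4k+2 σ (+-identityʳ _)))
                            (trans (p 0 4 refl) (t-4k+2 {2 + 4 * σ + 4} (suc σ) (solve (σ ∷ [])))))
    σ≡σ̄′ : t σ ≡ flip (t (suc σ))
    σ≡σ̄′ = trans (sym (t-4k+3 {2 + 4 * σ + 1} σ (solve (σ ∷ [])))) (trans (p 1 3 refl) (t-4k+1 {2 + 4 * σ + 3} (suc σ) (solve (σ ∷ []))))

  no-long-odd : ∀ h s → PalAt s (5 + 2 * h) → ⊥
  no-long-odd zero    s p = no-pal5 s p
  no-long-odd (suc h) s p = no-long-odd h (suc s) (peel (subst (PalAt s) (length≡ h) p))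
    where
    length≡ : ∀ h → 5 + 2 * suc h ≡ 2 + (5 + 2 * h)
    length≡ = solve-∀

  Bound : ℕ → Set
  Bound L = ∀ s → PalAt s L → f (s + L) ≤ suc (f s)

  bound-0 : Bound 0
  bound-0 s _ = ≤-trans (≤-reflexive (cong f (+-identityʳ s))) (n≤1+n _)

  bound-1 : Bound 1
  bound-1 s _ = ≤-trans (≤-reflexive (cong f (+-comm s 1))) (jump≤ (d s) (d-jump s))

  bound-3 : Bound 3
  bound-3 s p with mod4 s
  ... | rem0 σ = ⊥-elim (no-pal3-at-4k σ p)
  ... | rem1 σ = ⊥-elim (no-pal3-at-4k+1 σ p)
  ... | rem2 σ = begin
    f (2 + 4 * σ + 3)             ≡⟨ cong f (end σ) ⟩
    f (1 + 4 * suc σ)             ≡⟨ f-4k+1 (suc σ) ⟩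
    suc (f (suc σ))               ≤⟨ s≤s (⊓-glb (jump≤ (d σ) (d-jump σ)) (n≤1+n _)) ⟩
    2 + (f σ ⊓ f (suc σ))         ≤⟨ n≤1+n _ ⟩
    suc (2 + (f σ ⊓ f (suc σ)))   ≡⟨ cong suc (sym (f-4k+2 σ)) ⟩
    suc (f (2 + 4 * σ))           ∎
    where
    open ≤-Reasoning
    end : ∀ σ → 2 + 4 * σ + 3 ≡ 1 + 4 * suc σ
    end = solve-∀
  ... | rem3 σ = begin
    f (3 + 4 * σ + 3)                     ≡⟨ cong f (end σ) ⟩
    f (2 + 4 * suc σ)                     ≡⟨ f-4k+2 (suc σ) ⟩
    2 + (f (suc σ) ⊓ f (suc (suc σ)))     ≤⟨ s≤s (s≤s (m⊓n≤m _ _)) ⟩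
    suc (suc (f (suc σ)))                 ≡⟨ cong suc (sym (f-4k+3 σ)) ⟩
    suc (f (3 + 4 * σ))                   ∎
    where
    open ≤-Reasoning
    end : ∀ σ → 3 + 4 * σ + 3 ≡ 2 + 4 * suc σ
    end = solve-∀

  bound-4[1+q] : ∀ q → Bound q → Bound (suc q) → Bound (2 + q) → Bound (4 * suc q)
  bound-4[1+q] q bound-q bound-1+q bound-2+q s p with mod4 s
  -- starting at an odd position, the centre would split a pair t(2e) t(2e+1)
  ... | rem1 σ = ⊥-elim (even-centre _ (1 + 2 * q) (1 + 2 * σ + q) (centre≡ σ q) (subst (PalAt _) (length≡ q) p))
    where
    centre≡ : ∀ σ q → 1 + 4 * σ + (1 + 2 * q) ≡ 2 * (1 + 2 * σ + q)
    centre≡ = solve-∀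
    length≡ : ∀ q → 4 * suc q ≡ 2 + 2 * (1 + 2 * q)
    length≡ = solve-∀
  ... | rem3 σ = ⊥-elim (even-centre _ (1 + 2 * q) (2 + 2 * σ + q) (centre≡ σ q) (subst (PalAt _) (length≡ q) p))
    where
    centre≡ : ∀ σ q → 3 + 4 * σ + (1 + 2 * q) ≡ 2 * (2 + 2 * σ + q)
    centre≡ = solve-∀
    length≡ : ∀ q → 4 * suc q ≡ 2 + 2 * (1 + 2 * q)
    length≡ = solve-∀
  -- a palindrome of whole μ-blocks, the image of the palindrome t[σ, σ + q + 1)
  ... | rem0 σ = begin
    f (4 * σ + 4 * suc q)   ≡⟨ cong f (end σ q) ⟩
    f (4 * (σ + suc q))     ≡⟨ f-4k (σ + suc q) ⟩
    f (σ + suc q)           ≤⟨ bound-1+q σ (descend-4k σ (suc q) p) ⟩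
    suc (f σ)               ≡⟨ cong suc (sym (f-4k σ)) ⟩
    suc (f (4 * σ))         ∎
    where
    open ≤-Reasoning
    end : ∀ σ q → 4 * σ + 4 * suc q ≡ 4 * (σ + suc q)
    end = solve-∀
  -- t[2+4σ, 2+4σ+4q+4) is the image of t[σ+1, σ+q+1) wrapped in two letters on each side:
  -- both t[σ+1, σ+q+1) and t[σ, σ+q+2) are palindromes, and the two bounds combine via ⊓-jump.
  ... | rem2 σ = begin
    f (2 + 4 * σ + 4 * suc q)                             ≡⟨ cong f (end σ q) ⟩
    f (2 + 4 * (σ + suc q))                               ≡⟨ f-4k+2 (σ + suc q) ⟩
    2 + (f (σ + suc q) ⊓ f (suc (σ + suc q)))             ≤⟨ s≤s (s≤s (⊓-jump inner-bound outer-bound)) ⟩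
    suc (2 + (f σ ⊓ f (suc σ)))                           ≡⟨ cong suc (sym (f-4k+2 σ)) ⟩
    suc (f (2 + 4 * σ))                                   ∎
    where
    open ≤-Reasoning
    end : ∀ σ q → 2 + 4 * σ + 4 * suc q ≡ 2 + 4 * (σ + suc q)
    end = solve-∀
    length≡ : ∀ q → 4 * suc q ≡ 2 + (2 + 4 * q)
    length≡ = solve-∀
    last≡ : ∀ σ q → 2 + 4 * σ + suc (2 + 4 * q) ≡ 1 + 4 * (σ + suc q)
    last≡ = solve-∀
    p′ : PalAt (2 + 4 * σ) (2 + (2 + 4 * q))
    p′ = subst (PalAt _) (length≡ q) p
    inner : PalAt (suc σ) q
    inner = descend-4k (suc σ) q (at-4[1+k] (peel (peel p′)))
    outer : PalAt σ (2 + q)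
    outer = wrap (flip-injective (trans (sym (t-4k+2 σ refl))
                                  (trans (ends {2 + 4 * σ} {2 + 4 * q} p′) (t-4k+1 (σ + suc q) (last≡ σ q))))) inner
    inner-bound : f (σ + suc q) ≤ suc (f (suc σ))
    inner-bound = subst (λ x → f x ≤ suc (f (suc σ))) (sym (+-suc σ q)) (bound-q (suc σ) inner)
    outer-bound : f (suc (σ + suc q)) ≤ suc (f σ)
    outer-bound = subst (λ x → f x ≤ suc (f σ)) (+-suc σ (suc q)) (bound-2+q σ outer)

  bound-4q+2 : ∀ q → Bound q → Bound (suc q) → Bound (2 + 4 * q)
  bound-4q+2 q bound-q bound-1+q s p with mod4 s
  -- starting at an even position, the centre would split a pair t(2e) t(2e+1)
  ... | rem0 σ = ⊥-elim (even-centre _ (2 * q) (2 * σ + q) (centre≡ σ q) (subst (PalAt _) (length≡ q) p))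
    where
    centre≡ : ∀ σ q → 4 * σ + 2 * q ≡ 2 * (2 * σ + q)
    centre≡ = solve-∀
    length≡ : ∀ q → 2 + 4 * q ≡ 2 + 2 * (2 * q)
    length≡ = solve-∀
  ... | rem2 σ = ⊥-elim (even-centre _ (2 * q) (1 + 2 * σ + q) (centre≡ σ q) (subst (PalAt _) (length≡ q) p))
    where
    centre≡ : ∀ σ q → 2 + 4 * σ + 2 * q ≡ 2 * (1 + 2 * σ + q)
    centre≡ = solve-∀
    length≡ : ∀ q → 2 + 4 * q ≡ 2 + 2 * (2 * q)
    length≡ = solve-∀
  -- the image of the palindrome t[σ, σ + q + 1) without its outer letters
  ... | rem1 σ = begin
    f (1 + 4 * σ + (2 + 4 * q))   ≡⟨ cong f (end σ q) ⟩
    f (3 + 4 * (σ + q))           ≡⟨ f-4k+3 (σ + q) ⟩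
    suc (f (suc (σ + q)))         ≤⟨ s≤s (subst (λ x → f x ≤ suc (f σ)) (+-suc σ q) (bound-1+q σ (descend-4k+1 σ q p))) ⟩
    suc (suc (f σ))               ≡⟨ cong suc (sym (f-4k+1 σ)) ⟩
    suc (f (1 + 4 * σ))           ∎
    where
    open ≤-Reasoning
    end : ∀ σ q → 1 + 4 * σ + (2 + 4 * q) ≡ 3 + 4 * (σ + q)
    end = solve-∀
  -- the image of the palindrome t[σ+1, σ+q+1) with one more letter on each side
  ... | rem3 σ = begin
    f (3 + 4 * σ + (2 + 4 * q))   ≡⟨ cong f (end σ q) ⟩
    f (1 + 4 * (suc σ + q))       ≡⟨ f-4k+1 (suc σ + q) ⟩
    suc (f (suc σ + q))           ≤⟨ s≤s (bound-q (suc σ) (descend-4k (suc σ) q (at-4[1+k] (peel p)))) ⟩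
    suc (suc (f (suc σ)))         ≡⟨ cong suc (sym (f-4k+3 σ)) ⟩
    suc (f (3 + 4 * σ))           ∎
    where
    open ≤-Reasoning
    end : ∀ σ q → 3 + 4 * σ + (2 + 4 * q) ≡ 1 + 4 * (suc σ + q)
    end = solve-∀

  pal-bound : ∀ L → Bound L
  pal-bound = <-rec Bound step
    where
    2+q≤2+4q : ∀ q → 2 + q ≤ 2 + 4 * q
    2+q≤2+4q q = s≤s (s≤s (m≤n*m q 4))

    step : ∀ L → (∀ {L′} → L′ < L → Bound L′) → Bound L
    step L ih with mod4 L
    ... | rem0 zero    = bound-0
    ... | rem0 (suc q) = bound-4[1+q] q (ih (≤-trans (n≤1+n _) (≤-trans (n≤1+n _) (2+k<4[1+k] q))))
                                        (ih (≤-trans (n≤1+n _) (2+k<4[1+k] q))) (ih (2+k<4[1+k] q))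
    ... | rem1 zero    = bound-1
    ... | rem1 (suc q) = λ s p → ⊥-elim (no-long-odd (2 * q) s (subst (PalAt s) (length≡ q) p))
      where
      length≡ : ∀ q → 1 + 4 * suc q ≡ 5 + 2 * (2 * q)
      length≡ = solve-∀
    ... | rem2 q       = bound-4q+2 q (ih (≤-trans (n≤1+n _) (2+q≤2+4q q))) (ih (2+q≤2+4q q))
    ... | rem3 zero    = bound-3
    ... | rem3 (suc q) = λ s p → ⊥-elim (no-long-odd (1 + 2 * q) s (subst (PalAt s) (length≡ q) p))
      where
      length≡ : ∀ q → 3 + 4 * suc q ≡ 5 + 2 * (1 + 2 * q)
      length≡ = solve-∀

  PalSuffix : ℕ → Set
  PalSuffix n = Σ ℕ λ m → Σ ℕ λ L → (m + suc L ≡ n) × PalAt m (suc L) × (suc (f m) ≤ f n)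

  suffix-4k+1 : ∀ k → PalSuffix (1 + 4 * k)
  suffix-4k+1 k = 4 * k , 0 , +-comm (4 * k) 1 , pal-letter (4 * k) , ≤-reflexive (sym (jump-4k k))

  -- At 4(k + 1), take the μ-image of the palindromic suffix at k + 1.
  suffix-4[1+k] : ∀ k → PalSuffix (suc k) → PalSuffix (4 * suc k)
  suffix-4[1+k] k (m , L , end , p , f<) = 4 * m , 3 + 4 * L , end′ , p′ , f<′
    where
    end≡ : ∀ m L → 4 * m + suc (3 + 4 * L) ≡ 4 * (m + suc L)
    end≡ = solve-∀
    end′ : 4 * m + suc (3 + 4 * L) ≡ 4 * suc k
    end′ = trans (end≡ m L) (cong (4 *_) end)
    p′ : PalAt (4 * m) (4 + 4 * L)
    p′ = subst (PalAt (4 * m)) (sym (4+4k≡4[1+k] L)) (lift m (suc L) p)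
    f<′ : suc (f (4 * m)) ≤ f (4 * suc k)
    f<′ = subst₂ (λ x y → suc x ≤ y) (sym (f-4k m)) (sym (f-4k (suc k))) f<

  -- At 4k + 3, take the μ-image of the palindromic suffix at k + 1 without its outer letters.
  suffix-4k+3 : ∀ k → PalSuffix (suc k) → PalSuffix (3 + 4 * k)
  suffix-4k+3 k (m , L , end , p , f<) = 1 + 4 * m , 1 + 4 * L , end′ , p′ , f<′
    where
    end≡ : ∀ m L → 1 + 4 * m + suc (1 + 4 * L) ≡ 3 + 4 * (m + L)
    end≡ = solve-∀
    end′ : 1 + 4 * m + suc (1 + 4 * L) ≡ 3 + 4 * k
    end′ = trans (end≡ m L) (cong (λ x → 3 + 4 * x) (suc-injective (trans (sym (+-suc m L)) end)))
    p′ : PalAt (1 + 4 * m) (2 + 4 * L)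
    p′ = peel (subst (PalAt (4 * m)) (sym (4+4k≡4[1+k] L)) (lift m (suc L) p))
    f<′ : suc (f (1 + 4 * m)) ≤ f (3 + 4 * k)
    f<′ = subst₂ (λ x y → suc x ≤ y) (sym (f-4k+1 m)) (sym (f-4k+3 k)) (s≤s f<)

  -- At 4k + 2: if f k ≤ f (k + 1) the last letter will do; otherwise use the μ-image of the
  -- palindromic suffix at k + 1 without its two outer letters on each side.
  suffix-4k+2 : ∀ k → PalSuffix (suc k) → PalSuffix (2 + 4 * k)
  suffix-4k+2 k suffix with f k ≤? f (suc k)
  ... | yes fk≤ = 1 + 4 * k , 0 , +-comm (1 + 4 * k) 1 , pal-letter _ , ≤-reflexive (begin
    suc (f (1 + 4 * k))      ≡⟨ cong suc (f-4k+1 k) ⟩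
    2 + f k                  ≡⟨ cong (λ x → 2 + x) (sym (m≤n⇒m⊓n≡m fk≤)) ⟩
    2 + (f k ⊓ f (suc k))    ≡⟨ sym (f-4k+2 k) ⟩
    f (2 + 4 * k)            ∎)
    where open ≡-Reasoning
  ... | no fk≰ with suffix
  ...   | m , zero , end , _ , f< = ⊥-elim (fk≰ (≤-trans (n≤1+n _) (subst (λ x → suc (f x) ≤ f (suc k)) m≡k f<)))
    where
    m≡k : m ≡ k
    m≡k = suc-injective (trans (+-comm 1 m) end)
  ...   | m , suc L , end , p , f< = 2 + 4 * m , 3 + 4 * L , end′ , p′ , f<′
    where
    end≡ : ∀ m L → 2 + 4 * m + suc (3 + 4 * L) ≡ 2 + 4 * (m + suc L)
    end≡ = solve-∀
    end′ : 2 + 4 * m + suc (3 + 4 * L) ≡ 2 + 4 * k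
    end′ = trans (end≡ m L) (cong (λ x → 2 + 4 * x) (suc-injective (trans (sym (+-suc m (suc L))) end)))
    length≡ : ∀ L → 4 * suc (suc L) ≡ 2 + (2 + (4 + 4 * L))
    length≡ = solve-∀
    p′ : PalAt (2 + 4 * m) (4 + 4 * L)
    p′ = peel (peel (subst (PalAt (4 * m)) (length≡ L) (lift m (suc (suc L)) p)))
    f[k+1]≤fk : f (suc k) ≤ f k
    f[k+1]≤fk = ≤-trans (n≤1+n _) (≰⇒> fk≰)
    open ≤-Reasoning
    f<′ : suc (f (2 + 4 * m)) ≤ f (2 + 4 * k)
    f<′ = begin
      suc (f (2 + 4 * m))             ≡⟨ cong suc (f-4k+2 m) ⟩
      3 + (f m ⊓ f (suc m))           ≤⟨ s≤s (s≤s (s≤s (m⊓n≤m _ _))) ⟩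
      3 + f m                         ≤⟨ s≤s (s≤s f<) ⟩
      2 + f (suc k)                   ≡⟨ cong (λ x → 2 + x) (sym (m≥n⇒m⊓n≡n f[k+1]≤fk)) ⟩
      2 + (f k ⊓ f (suc k))           ≡⟨ sym (f-4k+2 k) ⟩
      f (2 + 4 * k)                   ∎

  pal-suffix : ∀ n → 0 < n → PalSuffix n
  pal-suffix = <-rec (λ n → 0 < n → PalSuffix n) step
    where
    step : ∀ n → (∀ {m} → m < n → 0 < m → PalSuffix m) → 0 < n → PalSuffix n
    step n ih 0<n with mod4 n
    ... | rem0 (suc k) = suffix-4[1+k] k (ih (≤-trans (n≤1+n _) (2+k<4[1+k] k)) (s≤s z≤n))
    ... | rem1 k       = suffix-4k+1 k
    ... | rem2 k       = suffix-4k+2 k (ih (s≤s (s≤s (m≤n*m k 4))) (s≤s z≤n))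
    ... | rem3 k       = suffix-4k+3 k (ih (s≤s (s≤s (≤-trans (m≤n*m k 4) (n≤1+n _)))) (s≤s z≤n))

  factorization-bound : ∀ ps s n → concat ps ≡ factor s n → All IsPalindrome ps → f (s + n) ≤ f s + length ps
  factorization-bound [] s zero _ _ = ≤-reflexive (trans (cong f (+-identityʳ s)) (sym (+-identityʳ (f s))))
  factorization-bound (p ∷ ps) s n concat≡ (pal All.∷ pals)
    with applyUpTo-split p (concat ps) (λ i → t (s + i)) n concat≡
  ... | m , len≡ , p≡ , rest≡ = begin
    f (s + n)                     ≡⟨ cong f (trans (cong (λ x → s + x) (sym len≡)) (sym (+-assoc s ℓ m))) ⟩
    f (s + ℓ + m)                 ≤⟨ factorization-bound ps (s + ℓ) m (trans rest≡ (shifted-factor s ℓ m)) pals ⟩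
    f (s + ℓ) + length ps         ≤⟨ +-monoˡ-≤ (length ps) (pal-bound ℓ s (palindrome⇒PalAt s ℓ (subst IsPalindrome p≡ pal))) ⟩
    suc (f s) + length ps         ≡⟨ sym (+-suc (f s) (length ps)) ⟩
    f s + length (p ∷ ps)         ∎
    where
    open ≤-Reasoning
    ℓ : ℕ
    ℓ = length p

  -- t[0, n) has a palindromic factorization into at most f n pieces:
  -- repeatedly split off a palindromic suffix that decreases f.
  short-factorization : ∀ n → Σ (PalFactorization (prefix t n)) λ fc → length (proj₁ fc) ≤ f n
  short-factorization = <-rec _ step
    where
    step : ∀ n → (∀ {m} → m < n → Σ (PalFactorization (prefix t m)) λ fc → length (proj₁ fc) ≤ f m) →
           Σ (PalFactorization (prefix t n)) λ fc → length (proj₁ fc) ≤ f n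
    step zero    _  = ([] , refl , All.[]) , z≤n
    step (suc n) ih with pal-suffix (suc n) (s≤s z≤n)
    ... | m , L , end , p , f< with ih (subst (m <_) end (m<m+n m (s≤s z≤n)))
    ... | (ps , concat≡ , pals) , len≤ = (ps ++ last ∷ [] , concat≡′ , ++⁺ pals (PalAt⇒palindrome m (suc L) p All.∷ All.[])) , len≤′
      where
      last : List Letter
      last = factor m (suc L)
      concat≡′ : concat (ps ++ last ∷ []) ≡ prefix t (suc n)
      concat≡′ = begin
        concat (ps ++ last ∷ [])          ≡⟨ sym (concat-++ ps (last ∷ [])) ⟩
        concat ps ++ last ++ []           ≡⟨ cong₂ _++_ concat≡ (++-identityʳ last) ⟩
        prefix t m ++ last                ≡⟨ applyUpTo-++ t m (suc L) ⟩
        prefix t (m + suc L)              ≡⟨ cong (prefix t) end ⟩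
        prefix t (suc n)                  ∎
        where open ≡-Reasoning
      len≤′ : length (ps ++ last ∷ []) ≤ f (suc n)
      len≤′ = begin
        length (ps ++ last ∷ [])  ≡⟨ trans (length-++ ps) (+-comm (length ps) 1) ⟩
        suc (length ps)           ≤⟨ s≤s len≤ ⟩
        suc (f m)                 ≤⟨ f< ⟩
        f (suc n)                 ∎
        where open ≤-Reasoning

  ppl : ∀ n → IsPPL (prefix t n) (f n)
  ppl n = IsPPL-intro (proj₁ (short-factorization n)) (proj₂ (short-factorization n))
            λ (ps , concat≡ , pals) → factorization-bound ps 0 n concat≡ pals

corollary14 : (t : ℕ → Letter) → IsFixedPoint μ a t →
    (∀ (n : ℕ) → ∃ λ k → IsPPL (prefix t n) k)
    × (Σ (ℕ → Sgn) λ d → IsFixedPoint δ pos d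
        × (∀ (n k₀ k₁ : ℕ) → IsPPL (prefix t n) k₀ → IsPPL (prefix t (suc n)) k₁ →
             toℤ (d n) ≡ (+ k₁) - (+ k₀)))
corollary14 t (_ , t-fixed) = (λ n → f n , ppl n) , d , d-fixedPoint , increments
  where
  open ThueMorse t t-fixed
  -- palindromic lengths are unique, so they are the values of f, whose increments are d
  increments : ∀ n k₀ k₁ → IsPPL (prefix t n) k₀ → IsPPL (prefix t (suc n)) k₁ → toℤ (d n) ≡ (+ k₁) - (+ k₀)
  increments n k₀ k₁ ppl₀ ppl₁ rewrite IsPPL-unique ppl₀ (ppl n) | IsPPL-unique ppl₁ (ppl (suc n)) =
    jump-ℤ (d n) (d-jump n)
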